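{- For all $\ell\in[k]$ and $j\in T$, $E[x'_\ell(j)]\leq\eta\cdot\frac{x^*_\ell(j)}{2}$.
   Context: Let $S=\{s_1,\dots,s_n\}$ be objects partitioned into clusters $C_1,\dots,C_k$, $T$ a finite set of tags, and $t_i\subseteq T$ the tag set of $s_i$; $M_\ell$ are integer coverage requirements. Let $E(j)=\{s_i: j\in t_i\}$ and $\eta=\max_j|E(j)|$. The LP $\mathcal{P}$ has variables $x_\ell(j)\in[0,1]$ ($j\in T,\ell\in[k]$) and $z(i)\in[0,1]$ ($s_i\in S$), minimizes $\sum_\ell\sum_jx_\ell(j)$ subject to $\sum_{j\in t_i}x_\ell(j)\geq z(i)$ for all $\ell$ and $s_i\in C_\ell$, $\sum_{s_i\in C_\ell}z(i)\geq M_\ell$ for all $\ell$, and $\sum_\ell x_\ell(j)\leq1$ for all $j$. Assume $\mathcal{P}$ is feasible and let $(x^*,z^*)$ be an optimal solution. Independently for each $s_i\in S$, set $Z(i)=1$ with probability $z^*(i)$ (and $Z(i)=0$ otherwise), and let $C'_\ell=\{s_i\in C_\ell: Z(i)=1\}$. For each $\ell,j$, define the random quantity $x'_\ell(j)=0$ if $E(j)\cap(\bigcup_{\ell'}C'_{\ell'})=\emptyset$, and otherwise $x'_\ell(j)=\frac{x^*_\ell(j)}{2}\cdot\max\{\frac1{z^*(i)}: s_i\in C'_\ell, j\in t_i\}$, where the maximum of an empty set is taken to be $0$. -}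

module Defs where

open import Level using (0ℓ)
open import Algebra.Bundles using (CommutativeRing)
open import Relation.Binary.Core using (Rel)
open import Relation.Binary.Structures using (IsTotalOrder)
open import Relation.Binary.Definitions using (Decidable)
open import Relation.Nullary using (¬_; yes; no)
open import Relation.Nullary.Decidable using (⌊_⌋)
open import Data.Nat as ℕ using (ℕ; zero; suc)
open import Data.Integer using (ℤ; +_; -[1+_])
open import Data.Bool using (Bool; true; false; if_then_else_; _∧_)
open import Data.Fin using (Fin; _≟_)
open import Data.Maybe using (Maybe; just; nothing; fromMaybe)
open import Data.Vec.Functional using (_∷_)
open import Data.Product using (_×_)

-- An ordered field (abstract, so that ℝ is an instance).  Real numbers
-- are not available in agda-stdlib; the statement is made for every
-- (discrete, totally) ordered field.  `_⁻¹` is a total operation whose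
-- value at 0 is unconstrained.

record OrderedField : Set₁ where
  field
    commutativeRing : CommutativeRing 0ℓ 0ℓ
  open CommutativeRing commutativeRing public
  infix 4 _≤_
  infix 9 _⁻¹
  field
    _≤_          : Rel Carrier 0ℓ
    isTotalOrder : IsTotalOrder _≈_ _≤_
    _≤?_         : Decidable _≤_
    +-monoˡ-≤    : ∀ {x y} z → x ≤ y → x + z ≤ y + z
    *-nonneg     : ∀ {x y} → 0# ≤ x → 0# ≤ y → 0# ≤ x * y
    _⁻¹          : Carrier → Carrier
    ⁻¹-inverse   : ∀ x → ¬ (x ≈ 0#) → x * x ⁻¹ ≈ 1#
    0≉1          : ¬ (0# ≈ 1#)

countℕ : (n : ℕ) → (Fin n → Bool) → ℕ
countℕ zero    p = 0
countℕ (suc n) p = (if p Fin.zero then 1 else 0) ℕ.+ countℕ n (λ i → p (Fin.suc i))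

maxℕ : (n : ℕ) → (Fin n → ℕ) → ℕ
maxℕ zero    f = 0
maxℕ (suc n) f = f Fin.zero ℕ.⊔ maxℕ n (λ i → f (Fin.suc i))

module WithField (F : OrderedField) where
  open OrderedField F

  fromℕ : ℕ → Carrier
  fromℕ zero    = 0#
  fromℕ (suc n) = 1# + fromℕ n

  fromℤ : ℤ → Carrier
  fromℤ (+ n)    = fromℕ n
  fromℤ -[1+ n ] = - fromℕ (suc n)

  half : Carrier → Carrier
  half x = x * (1# + 1#) ⁻¹

  sumF : (n : ℕ) → (Fin n → Carrier) → Carrier
  sumF zero    f = 0#
  sumF (suc n) f = f Fin.zero + sumF n (λ i → f (Fin.suc i))

  prodF : (n : ℕ) → (Fin n → Carrier) → Carrier
  prodF zero    f = 1#
  prodF (suc n) f = f Fin.zero * prodF n (λ i → f (Fin.suc i))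

  _⊔_ : Carrier → Carrier → Carrier
  x ⊔ y with x ≤? y
  ... | yes _ = y
  ... | no  _ = x

  maybeMax : Maybe Carrier → Carrier → Carrier
  maybeMax nothing  y = y
  maybeMax (just x) y = x ⊔ y

  maxOver : (n : ℕ) → (Fin n → Bool) → (Fin n → Carrier) → Maybe Carrier
  maxOver zero    p f = nothing
  maxOver (suc n) p f with p Fin.zero
  ... | true  = just (maybeMax (maxOver n (λ i → p (Fin.suc i)) (λ i → f (Fin.suc i))) (f Fin.zero))
  ... | false = maxOver n (λ i → p (Fin.suc i)) (λ i → f (Fin.suc i))

  sumOutcomes : (n : ℕ) → ((Fin n → Bool) → Carrier) → Carrier
  sumOutcomes zero    g = g (λ ())
  sumOutcomes (suc n) g = sumOutcomes n (λ Z → g (false ∷ Z)) + sumOutcomes n (λ Z → g (true ∷ Z))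

  -- The instance: n objects, k clusters (cluster i = ℓ means s_i ∈ C_ℓ),
  -- m tags (T = Fin m), tag i j = true means j ∈ t_i.

  module Instance (n k m : ℕ) (cluster : Fin n → Fin k) (tag : Fin n → Fin m → Bool)
                  (M : Fin k → ℤ) where

    inCluster : Fin k → Fin n → Bool
    inCluster ℓ i = ⌊ cluster i ≟ ℓ ⌋

    -- η = max_j |E(j)|
    η : ℕ
    η = maxℕ m (λ j → countℕ n (λ i → tag i j))

    InUnit : Carrier → Set
    InUnit v = (0# ≤ v) × (v ≤ 1#)

    Feasible : (Fin k → Fin m → Carrier) → (Fin n → Carrier) → Set
    Feasible x z =
      ((ℓ : Fin k) (j : Fin m) → InUnit (x ℓ j)) ×
      ((i : Fin n) → InUnit (z i)) ×
      ((ℓ : Fin k) (i : Fin n) → cluster i ≡′ ℓ →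
          z i ≤ sumF m (λ j → if tag i j then x ℓ j else 0#)) ×
      ((ℓ : Fin k) → fromℤ (M ℓ) ≤ sumF n (λ i → if inCluster ℓ i then z i else 0#)) ×
      ((j : Fin m) → sumF k (λ ℓ → x ℓ j) ≤ 1#)
      where open import Relation.Binary.PropositionalEquality renaming (_≡_ to _≡′_)

    objective : (Fin k → Fin m → Carrier) → Carrier
    objective x = sumF k (λ ℓ → sumF m (λ j → x ℓ j))

    Optimal : (Fin k → Fin m → Carrier) → (Fin n → Carrier) → Set
    Optimal x z = Feasible x z ×
      ((x′ : Fin k → Fin m → Carrier) (z′ : Fin n → Carrier) →
         Feasible x′ z′ → objective x ≤ objective x′)

    prob : (Fin n → Carrier) → (Fin n → Bool) → Carrier
    prob z Z = prodF n (λ i → if Z i then z i else 1# + - z i)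

    x′ : (Fin k → Fin m → Carrier) → (Fin n → Carrier) →
         (Fin n → Bool) → Fin k → Fin m → Carrier
    x′ x z Z ℓ j with countℕ n (λ i → tag i j ∧ Z i)
    ... | zero  = 0#
    ... | suc _ = half (x ℓ j) *
                  fromMaybe 0# (maxOver n (λ i → inCluster ℓ i ∧ (Z i ∧ tag i j)) (λ i → z i ⁻¹))

    expect-x′ : (Fin k → Fin m → Carrier) → (Fin n → Carrier) → Fin k → Fin m → Carrier
    expect-x′ x z ℓ j = sumOutcomes n (λ Z → prob z Z * x′ x z Z ℓ j)

-- For an outcome Z of the independent coin flips, the largest of the values
-- 1/z*(i) over s_i ∈ C'_ℓ with j ∈ t_i is at most their sum, so pointwise
--   x'_ℓ(j) ≤ (x*_ℓ(j)/2) · Σ_i [Z(i)] c(i),   c(i) = [s_i ∈ C_ℓ, j ∈ t_i] / z*(i).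
-- By linearity of expectation, E[Σ_i [Z(i)] c(i)] = Σ_i z*(i) c(i), and each
-- term z*(i) c(i) is at most [j ∈ t_i]; hence the expectation is bounded by
-- |E(j)| ≤ η.  Division by z*(i) = 0 is not controlled by the field axioms, so
-- c(i) uses the positive part of z*(i)⁻¹, which keeps every term nonnegative.

module Submission where

open import Defs
open import Data.Nat using (ℕ)
open import Data.Integer using (ℤ)
open import Data.Bool using (Bool)
open import Data.Fin using (Fin)

import Data.Nat as ℕ
import Data.Nat.Properties as ℕₚ
open import Data.Bool using (true; false; if_then_else_; _∧_)
open import Data.Maybe using (Maybe; just; nothing; fromMaybe)
open import Data.Vec.Functional using (_∷_)
open import Data.Product using (_×_; proj₁; proj₂)
open import Data.Sum using (inj₁; inj₂)
open import Data.Empty using (⊥-elim)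
open import Relation.Nullary using (yes; no; ¬_)
open import Relation.Binary.Bundles using (Poset)
open import Relation.Binary.Structures using (IsTotalOrder)
import Relation.Binary.Reasoning.PartialOrder as PartialOrderReasoning
import Relation.Binary.Reasoning.Setoid as SetoidReasoning
import Algebra.Properties.CommutativeSemigroup as CommSemigroupProperties
import Algebra.Properties.Group as GroupProperties
import Algebra.Properties.Ring as RingProperties

module OrderedFieldTheory (F : OrderedField) where
  open OrderedField F
  open WithField F
  private
    module TO = IsTotalOrder isTotalOrder
    module +-Props = CommSemigroupProperties +-commutativeSemigroup
    module *-Props = CommSemigroupProperties *-commutativeSemigroup
  open GroupProperties +-group using (//-rightDividesˡ)
  open RingProperties ring using (-1*x≈-x; -‿distribʳ-*; -‿involutive; [y-z]x≈yx-zx)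

  poset : Poset _ _ _
  poset = record { isPartialOrder = TO.isPartialOrder }

  module ≤-Reasoning = PartialOrderReasoning poset
  module ≈-Reasoning = SetoidReasoning setoid

  ≤-refl : ∀ {a} → a ≤ a
  ≤-refl = TO.refl

  ≈⇒≤ : ∀ {a b} → a ≈ b → a ≤ b
  ≈⇒≤ = TO.reflexive

  +-monoʳ-≤ : ∀ {x y} z → x ≤ y → z + x ≤ z + y
  +-monoʳ-≤ {x} {y} z x≤y = begin
    z + x  ≈⟨ +-comm z x ⟩
    x + z  ≤⟨ +-monoˡ-≤ z x≤y ⟩
    y + z  ≈⟨ +-comm y z ⟩
    z + y  ∎
    where open ≤-Reasoning

  +-mono-≤ : ∀ {a b c d} → a ≤ b → c ≤ d → a + c ≤ b + d
  +-mono-≤ {a} {b} {c} {d} a≤b c≤d = TO.trans (+-monoˡ-≤ c a≤b) (+-monoʳ-≤ b c≤d)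

  +-nonneg : ∀ {a b} → 0# ≤ a → 0# ≤ b → 0# ≤ a + b
  +-nonneg 0≤a 0≤b = TO.trans (≈⇒≤ (sym (+-identityˡ 0#))) (+-mono-≤ 0≤a 0≤b)

  ≤⇒0≤- : ∀ {a b} → a ≤ b → 0# ≤ b - a
  ≤⇒0≤- {a} {b} a≤b = TO.trans (≈⇒≤ (sym (-‿inverseʳ a))) (+-monoˡ-≤ (- a) a≤b)

  -- multiplication by a nonnegative element is monotone: c·b = c·a + c·(b - a)
  *-monoˡ-≤ : ∀ {a b c} → 0# ≤ c → a ≤ b → c * a ≤ c * b
  *-monoˡ-≤ {a} {b} {c} 0≤c a≤b = begin
    c * a                  ≈⟨ +-identityʳ (c * a) ⟨
    c * a + 0#             ≤⟨ +-monoʳ-≤ (c * a) (*-nonneg 0≤c (≤⇒0≤- a≤b)) ⟩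
    c * a + c * (b - a)    ≈⟨ distribˡ c a (b - a) ⟨
    c * (a + (b - a))      ≈⟨ *-cong refl (trans (+-comm a (b - a)) (//-rightDividesˡ a b)) ⟩
    c * b                  ∎
    where open ≤-Reasoning

  -- in an ordered ring 1 = (-1)·(-1) is a square, hence nonnegative
  0≤1 : 0# ≤ 1#
  0≤1 with TO.total 0# 1#
  ... | inj₁ 0≤1′ = 0≤1′
  ... | inj₂ 1≤0 = begin
    0#                          ≤⟨ *-nonneg 0≤-1 0≤-1 ⟩
    (0# - 1#) * (0# - 1#)       ≈⟨ *-cong (+-identityˡ (- 1#)) (+-identityˡ (- 1#)) ⟩
    - 1# * - 1#                 ≈⟨ -1*x≈-x (- 1#) ⟩
    - - 1#                      ≈⟨ -‿involutive 1# ⟩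
    1#                          ∎
    where
    open ≤-Reasoning
    0≤-1 : 0# ≤ 0# - 1#
    0≤-1 = ≤⇒0≤- 1≤0

  1≰0 : ¬ (1# ≤ 0#)
  1≰0 1≤0 = 0≉1 (TO.antisym 0≤1 1≤0)

  -- the inverse of a nonzero nonnegative element is nonnegative:
  -- otherwise -1 = z · (-z⁻¹) would be nonnegative
  ⁻¹-nonneg : ∀ {z} → 0# ≤ z → ¬ (z ≈ 0#) → 0# ≤ z ⁻¹
  ⁻¹-nonneg {z} 0≤z z≉0 with TO.total 0# (z ⁻¹)
  ... | inj₁ 0≤z⁻¹ = 0≤z⁻¹
  ... | inj₂ z⁻¹≤0 = ⊥-elim (1≰0 1≤0)
    where
    open ≤-Reasoning
    0≤-1 : 0# ≤ - 1#
    0≤-1 = begin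
      0#                   ≤⟨ *-nonneg 0≤z (≤⇒0≤- z⁻¹≤0) ⟩
      z * (0# - z ⁻¹)      ≈⟨ *-cong refl (+-identityˡ (- z ⁻¹)) ⟩
      z * - z ⁻¹           ≈⟨ -‿distribʳ-* z (z ⁻¹) ⟨
      - (z * z ⁻¹)         ≈⟨ -‿cong (⁻¹-inverse z z≉0) ⟩
      - 1#                 ∎
    1≤0 : 1# ≤ 0#
    1≤0 = begin
      1#            ≈⟨ +-identityˡ 1# ⟨
      0# + 1#       ≤⟨ +-monoˡ-≤ 1# 0≤-1 ⟩
      - 1# + 1#     ≈⟨ -‿inverseˡ 1# ⟩
      0#            ∎

  half-nonneg : ∀ {x} → 0# ≤ x → 0# ≤ half x
  half-nonneg 0≤x = *-nonneg 0≤x (⁻¹-nonneg (+-nonneg 0≤1 0≤1) 1+1≉0)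
    where
    1+1≉0 : ¬ (1# + 1# ≈ 0#)
    1+1≉0 1+1≈0 = 1≰0 (begin
      1#         ≈⟨ +-identityˡ 1# ⟨
      0# + 1#    ≤⟨ +-monoˡ-≤ 1# 0≤1 ⟩
      1# + 1#    ≈⟨ 1+1≈0 ⟩
      0#         ∎)
      where open ≤-Reasoning

  pos : Carrier → Carrier
  pos a with 0# ≤? a
  ... | yes _ = a
  ... | no  _ = 0#

  pos-nonneg : ∀ a → 0# ≤ pos a
  pos-nonneg a with 0# ≤? a
  ... | yes 0≤a = 0≤a
  ... | no  _   = ≤-refl

  ≤pos : ∀ a → a ≤ pos a
  ≤pos a with 0# ≤? a
  ... | yes _   = ≤-refl
  ... | no  0≰a with TO.total 0# a
  ...   | inj₁ 0≤a = ⊥-elim (0≰a 0≤a)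
  ...   | inj₂ a≤0 = a≤0

  ≤pos+ : ∀ y {s} → 0# ≤ s → y ≤ pos y + s
  ≤pos+ y {s} 0≤s = begin
    y             ≤⟨ ≤pos y ⟩
    pos y         ≈⟨ +-identityʳ (pos y) ⟨
    pos y + 0#    ≤⟨ +-monoʳ-≤ (pos y) 0≤s ⟩
    pos y + s     ∎
    where open ≤-Reasoning

  -- z · (z⁻¹)⁺ ≤ 1 for z ≥ 0: it equals 1 when z ≠ 0 and 0 when z = 0
  *-pos⁻¹≤1 : ∀ {z} → 0# ≤ z → z * pos (z ⁻¹) ≤ 1#
  *-pos⁻¹≤1 {z} 0≤z with 0# ≤? (z ⁻¹)
  ... | no  _ = TO.trans (≈⇒≤ (zeroʳ z)) 0≤1
  ... | yes _ with z ≤? 0#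
  ...   | yes z≤0 = TO.trans (≈⇒≤ (trans (*-cong (TO.antisym z≤0 0≤z) refl) (zeroˡ (z ⁻¹)))) 0≤1
  ...   | no  z≰0 = ≈⇒≤ (⁻¹-inverse z (λ z≈0 → z≰0 (≈⇒≤ z≈0)))

  sumF-nonneg : ∀ n (f : Fin n → Carrier) → (∀ i → 0# ≤ f i) → 0# ≤ sumF n f
  sumF-nonneg ℕ.zero    f f≥0 = ≤-refl
  sumF-nonneg (ℕ.suc n) f f≥0 = +-nonneg (f≥0 Fin.zero) (sumF-nonneg n _ (λ i → f≥0 (Fin.suc i)))

  sumF-mono : ∀ n (f g : Fin n → Carrier) → (∀ i → f i ≤ g i) → sumF n f ≤ sumF n g
  sumF-mono ℕ.zero    f g f≤g = ≤-refl
  sumF-mono (ℕ.suc n) f g f≤g = +-mono-≤ (f≤g Fin.zero) (sumF-mono n _ _ (λ i → f≤g (Fin.suc i)))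

  sumF-cong : ∀ n (f g : Fin n → Carrier) → (∀ i → f i ≈ g i) → sumF n f ≈ sumF n g
  sumF-cong ℕ.zero    f g f≈g = refl
  sumF-cong (ℕ.suc n) f g f≈g = +-cong (f≈g Fin.zero) (sumF-cong n _ _ (λ i → f≈g (Fin.suc i)))

  sumF-indicator : ∀ n (p : Fin n → Bool) →
    sumF n (λ i → if p i then 1# else 0#) ≈ fromℕ (countℕ n p)
  sumF-indicator ℕ.zero    p = refl
  sumF-indicator (ℕ.suc n) p with p Fin.zero
  ... | true  = +-cong refl (sumF-indicator n _)
  ... | false = trans (+-identityˡ _) (sumF-indicator n _)

  maxℕ-upper : ∀ m (f : Fin m → ℕ) j → f j ℕ.≤ maxℕ m f
  maxℕ-upper (ℕ.suc m) f Fin.zero    = ℕₚ.m≤m⊔n _ _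
  maxℕ-upper (ℕ.suc m) f (Fin.suc j) = ℕₚ.≤-trans (maxℕ-upper m _ j) (ℕₚ.m≤n⊔m (f Fin.zero) _)

  fromℕ-nonneg : ∀ a → 0# ≤ fromℕ a
  fromℕ-nonneg ℕ.zero    = ≤-refl
  fromℕ-nonneg (ℕ.suc a) = +-nonneg 0≤1 (fromℕ-nonneg a)

  fromℕ-mono : ∀ {a b} → a ℕ.≤ b → fromℕ a ≤ fromℕ b
  fromℕ-mono {b = b} ℕ.z≤n = fromℕ-nonneg b
  fromℕ-mono (ℕ.s≤s a≤b)   = +-monoʳ-≤ 1# (fromℕ-mono a≤b)

  maybeMax≤ : ∀ (mx : Maybe Carrier) y s → fromMaybe 0# mx ≤ s → 0# ≤ s →
    maybeMax mx y ≤ pos y + s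
  maybeMax≤ nothing  y s _   0≤s = ≤pos+ y 0≤s
  maybeMax≤ (just a) y s a≤s 0≤s with a ≤? y
  ... | yes _ = ≤pos+ y 0≤s
  ... | no  _ = begin
    a             ≤⟨ a≤s ⟩
    s             ≈⟨ +-identityˡ s ⟨
    0# + s        ≤⟨ +-monoˡ-≤ s (pos-nonneg y) ⟩
    pos y + s     ∎
    where open ≤-Reasoning

  maxOver≤sum-pos : ∀ n (p : Fin n → Bool) (f : Fin n → Carrier) →
    fromMaybe 0# (maxOver n p f) ≤ sumF n (λ i → if p i then pos (f i) else 0#)
  maxOver≤sum-pos ℕ.zero    p f = ≤-refl
  maxOver≤sum-pos (ℕ.suc n) p f with p Fin.zero
  ... | true  = maybeMax≤ (maxOver n p′ f′) (f Fin.zero) _ (maxOver≤sum-pos n p′ f′)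
                  (sumF-nonneg n _ (λ i → selected-nonneg (p′ i) (f′ i)))
    where
    p′ : Fin n → Bool
    p′ i = p (Fin.suc i)
    f′ : Fin n → Carrier
    f′ i = f (Fin.suc i)
    selected-nonneg : ∀ b a → 0# ≤ (if b then pos a else 0#)
    selected-nonneg true  a = pos-nonneg a
    selected-nonneg false a = ≤-refl
  ... | false = TO.trans (maxOver≤sum-pos n _ _) (≈⇒≤ (sym (+-identityˡ _)))

  sumOutcomes-mono : ∀ n (f g : (Fin n → Bool) → Carrier) → (∀ Z → f Z ≤ g Z) →
    sumOutcomes n f ≤ sumOutcomes n g
  sumOutcomes-mono ℕ.zero    f g f≤g = f≤g _
  sumOutcomes-mono (ℕ.suc n) f g f≤g =
    +-mono-≤ (sumOutcomes-mono n _ _ (λ Z → f≤g _)) (sumOutcomes-mono n _ _ (λ Z → f≤g _))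

  sumOutcomes-cong : ∀ n (f g : (Fin n → Bool) → Carrier) → (∀ Z → f Z ≈ g Z) →
    sumOutcomes n f ≈ sumOutcomes n g
  sumOutcomes-cong ℕ.zero    f g f≈g = f≈g _
  sumOutcomes-cong (ℕ.suc n) f g f≈g =
    +-cong (sumOutcomes-cong n _ _ (λ Z → f≈g _)) (sumOutcomes-cong n _ _ (λ Z → f≈g _))

  sumOutcomes-+ : ∀ n (f g : (Fin n → Bool) → Carrier) →
    sumOutcomes n (λ Z → f Z + g Z) ≈ sumOutcomes n f + sumOutcomes n g
  sumOutcomes-+ ℕ.zero    f g = refl
  sumOutcomes-+ (ℕ.suc n) f g =
    trans (+-cong (sumOutcomes-+ n _ _) (sumOutcomes-+ n _ _)) (+-Props.interchange _ _ _ _)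

  sumOutcomes-*ˡ : ∀ n a (f : (Fin n → Bool) → Carrier) →
    sumOutcomes n (λ Z → a * f Z) ≈ a * sumOutcomes n f
  sumOutcomes-*ˡ ℕ.zero    a f = refl
  sumOutcomes-*ˡ (ℕ.suc n) a f =
    trans (+-cong (sumOutcomes-*ˡ n a _) (sumOutcomes-*ˡ n a _)) (sym (distribˡ a _ _))

  bernoulli : ∀ n → (Fin n → Carrier) → (Fin n → Bool) → Carrier
  bernoulli n p Z = prodF n (λ i → if Z i then p i else 1# - p i)

  𝔼 : ∀ n → (Fin n → Carrier) → ((Fin n → Bool) → Carrier) → Carrier
  𝔼 n p g = sumOutcomes n (λ Z → bernoulli n p Z * g Z)

  bernoulli-nonneg : ∀ n (p : Fin n → Carrier) → (∀ i → 0# ≤ p i × p i ≤ 1#) →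
    ∀ Z → 0# ≤ bernoulli n p Z
  bernoulli-nonneg ℕ.zero    p p∈[0,1] Z = 0≤1
  bernoulli-nonneg (ℕ.suc n) p p∈[0,1] Z =
    *-nonneg (factor-nonneg (Z Fin.zero))
             (bernoulli-nonneg n _ (λ i → p∈[0,1] (Fin.suc i)) (λ i → Z (Fin.suc i)))
    where
    factor-nonneg : ∀ b → 0# ≤ (if b then p Fin.zero else 1# - p Fin.zero)
    factor-nonneg true  = proj₁ (p∈[0,1] Fin.zero)
    factor-nonneg false = ≤⇒0≤- (proj₂ (p∈[0,1] Fin.zero))

  𝔼-mono : ∀ n (p : Fin n → Carrier) → (∀ i → 0# ≤ p i × p i ≤ 1#) →
    ∀ (f g : (Fin n → Bool) → Carrier) → (∀ Z → f Z ≤ g Z) → 𝔼 n p f ≤ 𝔼 n p g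
  𝔼-mono n p p∈[0,1] f g f≤g =
    sumOutcomes-mono n _ _ (λ Z → *-monoˡ-≤ (bernoulli-nonneg n p p∈[0,1] Z) (f≤g Z))

  𝔼-cong : ∀ n p (f g : (Fin n → Bool) → Carrier) → (∀ Z → f Z ≈ g Z) → 𝔼 n p f ≈ 𝔼 n p g
  𝔼-cong n p f g f≈g = sumOutcomes-cong n _ _ (λ Z → *-cong refl (f≈g Z))

  𝔼-+ : ∀ n p (f g : (Fin n → Bool) → Carrier) →
    𝔼 n p (λ Z → f Z + g Z) ≈ 𝔼 n p f + 𝔼 n p g
  𝔼-+ n p f g = trans (sumOutcomes-cong n _ _ (λ Z → distribˡ _ (f Z) (g Z))) (sumOutcomes-+ n _ _)

  𝔼-*ˡ : ∀ n p a (f : (Fin n → Bool) → Carrier) → 𝔼 n p (λ Z → a * f Z) ≈ a * 𝔼 n p f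
  𝔼-*ˡ n p a f =
    trans (sumOutcomes-cong n _ _ (λ Z → *-Props.x∙yz≈y∙xz _ a (f Z))) (sumOutcomes-*ˡ n a _)

  𝔼-step : ∀ n p (g : (Fin (ℕ.suc n) → Bool) → Carrier) →
    𝔼 (ℕ.suc n) p g ≈ (1# - p Fin.zero) * 𝔼 n (λ i → p (Fin.suc i)) (λ Z → g (false ∷ Z))
                      + p Fin.zero * 𝔼 n (λ i → p (Fin.suc i)) (λ Z → g (true ∷ Z))
  𝔼-step n p g = +-cong (conditional (1# - p Fin.zero) false) (conditional (p Fin.zero) true)
    where
    conditional : ∀ a b → sumOutcomes n (λ Z → (a * bernoulli n (λ i → p (Fin.suc i)) Z) * g (b ∷ Z))
                          ≈ a * 𝔼 n (λ i → p (Fin.suc i)) (λ Z → g (b ∷ Z))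
    conditional a b = trans (sumOutcomes-cong n _ _ (λ Z → *-assoc a _ _)) (sumOutcomes-*ˡ n a _)

  convex-same : ∀ a u → (1# - a) * u + a * u ≈ u
  convex-same a u = begin
    (1# - a) * u + a * u        ≈⟨ +-cong ([y-z]x≈yx-zx u 1# a) refl ⟩
    (1# * u - a * u) + a * u    ≈⟨ //-rightDividesˡ (a * u) (1# * u) ⟩
    1# * u                      ≈⟨ *-identityˡ u ⟩
    u                           ∎
    where open ≈-Reasoning

  convex-shift : ∀ a c u → (1# - a) * u + a * (c + u) ≈ a * c + u
  convex-shift a c u = begin
    (1# - a) * u + a * (c + u)          ≈⟨ +-cong refl (distribˡ a c u) ⟩
    (1# - a) * u + (a * c + a * u)      ≈⟨ +-Props.x∙yz≈y∙xz _ (a * c) (a * u) ⟩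
    a * c + ((1# - a) * u + a * u)      ≈⟨ +-cong refl (convex-same a u) ⟩
    a * c + u                           ∎
    where open ≈-Reasoning

  𝔼-const : ∀ n p c → 𝔼 n p (λ _ → c) ≈ c
  𝔼-const ℕ.zero    p c = *-identityˡ c
  𝔼-const (ℕ.suc n) p c = begin
    𝔼 (ℕ.suc n) p (λ _ → c)                        ≈⟨ 𝔼-step n p (λ _ → c) ⟩
    (1# - p Fin.zero) * 𝔼 n p′ (λ _ → c) + p Fin.zero * 𝔼 n p′ (λ _ → c)
                                                   ≈⟨ +-cong (*-cong refl IH) (*-cong refl IH) ⟩
    (1# - p Fin.zero) * c + p Fin.zero * c         ≈⟨ convex-same (p Fin.zero) c ⟩
    c                                              ∎
    where
    open ≈-Reasoning
    p′ : Fin n → Carrier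
    p′ i = p (Fin.suc i)
    IH : 𝔼 n p′ (λ _ → c) ≈ c
    IH = 𝔼-const n p′ c

  𝔼-indicator-sum : ∀ n p (c : Fin n → Carrier) →
    𝔼 n p (λ Z → sumF n (λ i → if Z i then c i else 0#)) ≈ sumF n (λ i → p i * c i)
  𝔼-indicator-sum ℕ.zero    p c = zeroʳ _
  𝔼-indicator-sum (ℕ.suc n) p c = begin
    𝔼 (ℕ.suc n) p S                                          ≈⟨ 𝔼-step n p S ⟩
    (1# - p₀) * 𝔼 n p′ (λ Z → 0# + S′ Z) + p₀ * 𝔼 n p′ (λ Z → c₀ + S′ Z)
      ≈⟨ +-cong (*-cong refl given-0) (*-cong refl given-1) ⟩
    (1# - p₀) * X + p₀ * (c₀ + X)                            ≈⟨ convex-shift p₀ c₀ X ⟩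
    p₀ * c₀ + X                                              ∎
    where
    open ≈-Reasoning
    p₀ c₀ : Carrier
    p₀ = p Fin.zero
    c₀ = c Fin.zero
    p′ c′ : Fin n → Carrier
    p′ i = p (Fin.suc i)
    c′ i = c (Fin.suc i)
    S : (Fin (ℕ.suc n) → Bool) → Carrier
    S Z = sumF (ℕ.suc n) (λ i → if Z i then c i else 0#)
    S′ : (Fin n → Bool) → Carrier
    S′ Z = sumF n (λ i → if Z i then c′ i else 0#)
    X : Carrier
    X = sumF n (λ i → p′ i * c′ i)
    IH : 𝔼 n p′ S′ ≈ X
    IH = 𝔼-indicator-sum n p′ c′
    given-0 : 𝔼 n p′ (λ Z → 0# + S′ Z) ≈ X
    given-0 = trans (𝔼-cong n p′ _ _ (λ Z → +-identityˡ (S′ Z))) IH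
    given-1 : 𝔼 n p′ (λ Z → c₀ + S′ Z) ≈ c₀ + X
    given-1 = trans (𝔼-+ n p′ _ _) (+-cong (𝔼-const n p′ c₀) IH)

  module InstanceBounds (n k m : ℕ) (cluster : Fin n → Fin k) (tag : Fin n → Fin m → Bool)
           (M : Fin k → ℤ) where
    open Instance n k m cluster tag M

    weight : (Fin n → Carrier) → Fin k → Fin m → Fin n → Carrier
    weight z ℓ j i = if inCluster ℓ i ∧ tag i j then pos (z i ⁻¹) else 0#

    select-regroup : ∀ a b t g →
      (if a ∧ (b ∧ t) then g else 0#) ≈ (if b then (if a ∧ t then g else 0#) else 0#)
    select-regroup true  true  t g = refl
    select-regroup true  false t g = refl
    select-regroup false true  t g = refl
    select-regroup false false t g = refl

    x′≤half·weighted : ∀ x z Z ℓ j → 0# ≤ x ℓ j →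
      x′ x z Z ℓ j ≤ half (x ℓ j) * sumF n (λ i → if Z i then weight z ℓ j i else 0#)
    x′≤half·weighted x z Z ℓ j 0≤x with countℕ n (λ i → tag i j ∧ Z i)
    ... | ℕ.zero  = *-nonneg (half-nonneg 0≤x) (sumF-nonneg n _ chosen-nonneg)
      where
      chosen-nonneg : ∀ i → 0# ≤ (if Z i then weight z ℓ j i else 0#)
      chosen-nonneg i with Z i | inCluster ℓ i ∧ tag i j
      ... | true  | true  = pos-nonneg (z i ⁻¹)
      ... | true  | false = ≤-refl
      ... | false | _     = ≤-refl
    ... | ℕ.suc _ = *-monoˡ-≤ (half-nonneg 0≤x)
      (TO.trans (maxOver≤sum-pos n _ _)
                (≈⇒≤ (sumF-cong n _ _ (λ i → select-regroup (inCluster ℓ i) (Z i) (tag i j) _))))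

    expected-weight≤η : ∀ z ℓ j → (∀ i → 0# ≤ z i) →
      sumF n (λ i → z i * weight z ℓ j i) ≤ fromℕ η
    expected-weight≤η z ℓ j 0≤z = begin
      sumF n (λ i → z i * weight z ℓ j i)          ≤⟨ sumF-mono n _ _ term≤indicator ⟩
      sumF n (λ i → if tag i j then 1# else 0#)    ≈⟨ sumF-indicator n (λ i → tag i j) ⟩
      fromℕ (countℕ n (λ i → tag i j))             ≤⟨ fromℕ-mono (maxℕ-upper m _ j) ⟩
      fromℕ η                                      ∎
      where
      open ≤-Reasoning
      term≤indicator : ∀ i → z i * weight z ℓ j i ≤ (if tag i j then 1# else 0#)
      term≤indicator i with inCluster ℓ i | tag i j
      ... | true  | true  = *-pos⁻¹≤1 (0≤z i)
      ... | true  | false = ≈⇒≤ (zeroʳ _)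
      ... | false | true  = TO.trans (≈⇒≤ (zeroʳ _)) 0≤1
      ... | false | false = ≈⇒≤ (zeroʳ _)

lemma5 : (F : OrderedField) →
    let open OrderedField F in
    let open WithField F in
    (n k m : ℕ) (cluster : Fin n → Fin k) (tag : Fin n → Fin m → Bool) (M : Fin k → ℤ) →
    let open Instance n k m cluster tag M in
    (x : Fin k → Fin m → Carrier) (z : Fin n → Carrier) → Optimal x z →
    (ℓ : Fin k) (j : Fin m) →
    expect-x′ x z ℓ j ≤ fromℕ η * half (x ℓ j)
lemma5 F n k m cluster tag M x z optimal ℓ j = begin
  𝔼 n z (λ Z → x′ x z Z ℓ j)
    ≤⟨ 𝔼-mono n z z∈[0,1] _ _ (λ Z → x′≤half·weighted x z Z ℓ j 0≤x) ⟩
  𝔼 n z (λ Z → h * weighted Z)        ≈⟨ 𝔼-*ˡ n z h weighted ⟩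
  h * 𝔼 n z weighted                  ≈⟨ *-cong refl (𝔼-indicator-sum n z (weight z ℓ j)) ⟩
  h * sumF n (λ i → z i * weight z ℓ j i)
    ≤⟨ *-monoˡ-≤ (half-nonneg 0≤x) (expected-weight≤η z ℓ j (λ i → proj₁ (z∈[0,1] i))) ⟩
  h * fromℕ η                         ≈⟨ *-comm h (fromℕ η) ⟩
  fromℕ η * h                         ∎
  where
  open OrderedField F
  open WithField F
  open Instance n k m cluster tag M
  open OrderedFieldTheory F
  open InstanceBounds n k m cluster tag M
  open ≤-Reasoning
  -- only feasibility is used: x_ℓ(j) ≥ 0 and z(i) ∈ [0,1]
  0≤x : 0# ≤ x ℓ j
  0≤x = proj₁ (proj₁ (proj₁ optimal) ℓ j)
  z∈[0,1] : ∀ i → 0# ≤ z i × z i ≤ 1#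
  z∈[0,1] = proj₁ (proj₂ (proj₁ optimal))
  h : Carrier
  h = half (x ℓ j)
  weighted : (Fin n → Bool) → Carrier
  weighted Z = sumF n (λ i → if Z i then weight z ℓ j i else 0#)
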